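{- Fix any $1\le c\le h$. At any moment during the execution of the decomposition algorithm, if the left endpoint of the first interval in $L_c$ is $x$, then the refined segments stored in $\mathrm{RS}[c]$ partition the interval $[1,x-1]$ and the intervals stored in $L_c$ partition $[x,m]$.
   Context: Setting: haplotypes $S_1,\dots,S_h$ of length $m$; prefix array $\mathrm{PA}$ ($h\times m$, column $1$ is $1,\dots,h$, column $j>1$ sorts indices by co-lexicographic order of $S_i[1..j-1]$, ties broken stably); PBWT with $\mathrm{col}_j(\mathrm{PBWT})[x]=S_{\mathrm{col}_j(\mathrm{PA})[x]}[j]$; $(x,j)$ is a run-top if $x=1$ or $\mathrm{col}_j(\mathrm{PBWT})[x]\ne\mathrm{col}_j(\mathrm{PBWT})[x-1]$. Haplotype intervals of $S_i$: with $b_1<\dots<b_k=m$ the set of $m$ and all columns $j$ such that some run-top $(x,j)$ has $\mathrm{col}_j(\mathrm{PA})[x]=i$, they are $[1,b_1],[b_1+1,b_2],\dots,[b_{k-1}+1,b_k]$. Two intervals overlap if they share an integer. Decomposition algorithm with integer parameter $d>1$: initially, for each $c$, $L_c$ is the linked list of haplotype intervals of $S_c$ in increasing order and $\mathrm{RS}[c]$ is an empty list. For $j=1,\dots,m$ and, within each $j$, for $i=1,\dots,h$: let $c=\mathrm{col}_j(\mathrm{PA})[i]$ and let $[b_c,e_c]$ be the first interval of $L_c$ (Retrieval). If $j=e_c$, remove $[b_c,e_c]$ from $L_c$ and append it to the tail of $\mathrm{RS}[c]$ (Passive Split). Otherwise, if $i>1$ and $[b_c,j]$ overlaps exactly $d$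 refined segments currently in $\mathrm{RS}[c']$, where $c'=\mathrm{col}_j(\mathrm{PA})[i-1]$, append $[b_c,j]$ to the tail of $\mathrm{RS}[c]$, remove $[b_c,e_c]$ from $L_c$ and insert $[j+1,e_c]$ at the head of $L_c$ (Active Split). Intervals in the lists $\mathrm{RS}[\cdot]$ are called refined segments. -}

module Defs where

open import Data.Nat using (ℕ; zero; suc; _+_; _∸_; _≤_; _<_; _≤ᵇ_; _<ᵇ_; _≡ᵇ_; _⊔_; _⊓_)
open import Data.Bool using (Bool; true; false; if_then_else_; _∧_; _∨_; not)
open import Data.List using (List; []; _∷_; _++_; map; upTo; concatMap; scanl; [_])
open import Data.Bool.ListAction using (any)
open import Data.Nat.ListAction using (sum)
open import Data.List.Relation.Unary.All using (All)
open import Data.List.Relation.Unary.Any using (Any)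
open import Data.List.Relation.Unary.AllPairs using (AllPairs)
open import Data.Product using (_×_; _,_; Σ; ∃; proj₁; proj₂)
open import Data.Sum using (_⊎_)
open import Relation.Nullary using (¬_)
open import Relation.Binary.PropositionalEquality using (_≡_)

-- Conventions: haplotypes are S : ℕ → ℕ → ℕ, S i j = S_i[j] (1-based; only
-- 1 ≤ i ≤ h, 1 ≤ j ≤ m are relevant). Alphabet: ℕ with its usual order.
-- The prefix array is a function PA j x = col_j(PA)[x] (1-based).

oneTo : ℕ → List ℕ
oneTo n = map suc (upTo n)

ColexLess : (ℕ → ℕ → ℕ) → ℕ → ℕ → ℕ → Set
ColexLess S k a b =
  ∃ λ t → 1 ≤ t × t ≤ k × S a t < S b t ×
          (∀ t' → t < t' → t' ≤ k → S a t' ≡ S b t')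

ColexEq : (ℕ → ℕ → ℕ) → ℕ → ℕ → ℕ → Set
ColexEq S k a b = ∀ t → 1 ≤ t → t ≤ k → S a t ≡ S b t

PrecPA : (ℕ → ℕ → ℕ) → ℕ → ℕ → ℕ → Set
PrecPA S j a b = ColexLess S (j ∸ 1) a b ⊎ (ColexEq S (j ∸ 1) a b × a < b)

IsPrefixArray : ℕ → ℕ → (ℕ → ℕ → ℕ) → (ℕ → ℕ → ℕ) → Set
IsPrefixArray h m S PA =
  ∀ j → 1 ≤ j → j ≤ m →
    (∀ x → 1 ≤ x → x ≤ h → 1 ≤ PA j x × PA j x ≤ h) ×
    (∀ x x' → 1 ≤ x → x < x' → x' ≤ h → PrecPA S j (PA j x) (PA j x'))

PBWT : (ℕ → ℕ → ℕ) → (ℕ → ℕ → ℕ) → ℕ → ℕ → ℕ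
PBWT S PA j x = S (PA j x) j

runTop : (ℕ → ℕ → ℕ) → (ℕ → ℕ → ℕ) → ℕ → ℕ → Bool
runTop S PA j x = (x ≡ᵇ 1) ∨ not (PBWT S PA j x ≡ᵇ PBWT S PA j (x ∸ 1))

isBoundary : ℕ → ℕ → (ℕ → ℕ → ℕ) → (ℕ → ℕ → ℕ) → ℕ → ℕ → Bool
isBoundary h m S PA c j =
  (j ≡ᵇ m) ∨ any (λ x → runTop S PA j x ∧ (PA j x ≡ᵇ c)) (oneTo h)

-- closed integer interval [lo , hi]
Interval : Set
Interval = ℕ × ℕ

hapGo : (ℕ → Bool) → ℕ → ℕ → ℕ → List Interval
hapGo bd s j zero    = []
hapGo bd s j (suc k) =
  if bd j then (s , j) ∷ hapGo bd (suc j) (suc j) k else hapGo bd s (suc j) k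

hapIntervals : ℕ → ℕ → (ℕ → ℕ → ℕ) → (ℕ → ℕ → ℕ) → ℕ → List Interval
hapIntervals h m S PA c = hapGo (isBoundary h m S PA c) 1 1 m

overlapsᵇ : Interval → Interval → Bool
overlapsᵇ (a₁ , b₁) (a₂ , b₂) = (a₁ ⊔ a₂) ≤ᵇ (b₁ ⊓ b₂)

countOverlaps : Interval → List Interval → ℕ
countOverlaps I Js = sum (map (λ J → if overlapsᵇ I J then 1 else 0) Js)

record State : Set where
  constructor state
  field
    L  : ℕ → List Interval
    RS : ℕ → List Interval

update : {A : Set} → (ℕ → A) → ℕ → A → ℕ → A
update f c v c' = if c' ≡ᵇ c then v else f c'

initState : ℕ → ℕ → (ℕ → ℕ → ℕ) → (ℕ → ℕ → ℕ) → State
initState h m S PA = state (hapIntervals h m S PA) (λ _ → [])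

stepWith : ℕ → (ℕ → ℕ → ℕ) → ℕ → ℕ → ℕ → State → List Interval → State
stepWith d PA j i c st [] = st
stepWith d PA j i c (state L RS) ((b , e) ∷ rest) =
  if j ≡ᵇ e
  then state (update L c rest) (update RS c (RS c ++ [ (b , e) ]))
  else if (1 <ᵇ i) ∧ (countOverlaps (b , j) (RS (PA j (i ∸ 1))) ≡ᵇ d)
  then state (update L c ((suc j , e) ∷ rest))
             (update RS c (RS c ++ [ (b , j) ]))
  else state L RS

step : ℕ → (ℕ → ℕ → ℕ) → State → ℕ × ℕ → State
step d PA st (j , i) = stepWith d PA j i (PA j i) st (State.L st (PA j i))

schedule : ℕ → ℕ → List (ℕ × ℕ)
schedule h m = concatMap (λ j → map (λ i → (j , i)) (oneTo h)) (oneTo m)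

states : ℕ → ℕ → ℕ → (ℕ → ℕ → ℕ) → (ℕ → ℕ → ℕ) → List State
states h m d S PA = scanl (step d PA) (initState h m S PA) (schedule h m)

Overlap : Interval → Interval → Set
Overlap (a₁ , b₁) (a₂ , b₂) = ∃ λ y → a₁ ≤ y × y ≤ b₁ × a₂ ≤ y × y ≤ b₂

Partitions : List Interval → ℕ → ℕ → Set
Partitions Is a b =
  All (λ I → proj₁ I ≤ proj₂ I × a ≤ proj₁ I × proj₂ I ≤ b) Is ×
  AllPairs (λ I J → ¬ Overlap I J) Is ×
  (∀ y → a ≤ y → y ≤ b → Any (λ I → proj₁ I ≤ y × y ≤ proj₂ I) Is)

{-# OPTIONS --safe #-}
-- Throughout the execution, RS[c] followed by L_c is a list of consecutive nonempty
-- intervals tiling [1, m], and the head of L_c contains the column being processed. Each column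
-- of the prefix array is injective on [1, h] (its entries are strictly sorted), hence a
-- permutation, so every column visits c exactly once. At that visit a passive split moves the
-- head [b, e] to RS[c] when j = e, and otherwise j < e, so an active split cuts it into the
-- nonempty pieces [b, j] and [j + 1, e]; in every case the head again contains column j + 1.
module Submission where

open import Defs
open import Data.Bool using (Bool; true; false; if_then_else_; T; _∧_)
open import Data.Bool.Properties using (T-∨)
open import Data.Fin using (Fin; toℕ; fromℕ<; punchOut)
open import Data.Fin.Properties
  using (any?; injective⇒≤; punchOut-injective; toℕ<n; toℕ-injective; fromℕ<-injective)
  renaming (_≟_ to _≟ᶠ_)
open import Data.List using (List; []; _∷_; _++_; [_]; map; foldl; scanl; concatMap; upTo)
open import Data.List.Properties using (foldl-++; concatMap-++; map-++; ++-identityʳ; upTo-∷ʳ)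
open import Data.List.Membership.Propositional using (_∈_)
open import Data.List.Membership.Propositional.Properties using (∈-upTo⁺)
open import Data.List.Relation.Unary.All as All using (All; []; _∷_)
open import Data.List.Relation.Unary.All.Properties using (All¬⇒¬Any)
open import Data.List.Relation.Unary.Any as Any using (Any; here; there)
open import Data.List.Relation.Unary.Any.Properties as Any using ()
open import Data.List.Relation.Unary.AllPairs using (AllPairs; []; _∷_)
import Data.List.Relation.Unary.AllPairs.Properties as AllPairs
open import Data.Nat using (ℕ; zero; suc; pred; _+_; _≤_; _<_; _∸_; _≡ᵇ_; _<ᵇ_; z≤n; s≤s; s≤s⁻¹; _≤?_)
open import Data.Nat.Properties
open import Data.Product using (_×_; _,_; ∃; proj₁; proj₂; uncurry)
open import Data.Sum using (inj₁; inj₂)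
open import Function.Base using (id; _∘_)
open import Function.Bundles using (Equivalence)
open import Function.Definitions using (Injective)
open import Relation.Binary.Definitions using (tri<; tri≈; tri>)
open import Relation.Nullary using (¬_; yes; no; contradiction)
open import Relation.Nullary.Decidable using (dec-true; dec-false)
open import Relation.Binary.PropositionalEquality using (_≡_; _≢_; refl; sym; trans; cong; cong₂; subst; module ≡-Reasoning)

-- Tiling a Is b: the nonempty consecutive intervals Is cover [a, b - 1] (b is exclusive).
data Tiling : ℕ → List Interval → ℕ → Set where
  []  : ∀ {a} → Tiling a [] a
  _∷_ : ∀ {a e b Is} → a ≤ e → Tiling (suc e) Is b → Tiling a ((a , e) ∷ Is) b

tiling-≤ : ∀ {a Is b} → Tiling a Is b → a ≤ b
tiling-≤ []        = ≤-refl
tiling-≤ (a≤e ∷ t) = ≤-trans a≤e (<⇒≤ (tiling-≤ t))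

tiling-bounds : ∀ {a Is b} → Tiling a Is (suc b) →
                All (λ I → proj₁ I ≤ proj₂ I × a ≤ proj₁ I × proj₂ I ≤ b) Is
tiling-bounds []        = []
tiling-bounds (a≤e ∷ t) =
  (a≤e , ≤-refl , s≤s⁻¹ (tiling-≤ t)) ∷
  All.map (λ (s≤e′ , e<s , e′≤b) → s≤e′ , ≤-trans a≤e (<⇒≤ e<s) , e′≤b) (tiling-bounds t)

tiling-disjoint : ∀ {a Is b} → Tiling a Is (suc b) → AllPairs (λ I J → ¬ Overlap I J) Is
tiling-disjoint []        = []
tiling-disjoint (_ ∷ t) =
  All.map (λ (_ , e<s , _) (_ , _ , y≤e , s≤y , _) → <⇒≱ (<-≤-trans e<s s≤y) y≤e) (tiling-bounds t)
  ∷ tiling-disjoint t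

tiling-covers : ∀ {a Is b y} → Tiling a Is b → a ≤ y → y < b →
                Any (λ I → proj₁ I ≤ y × y ≤ proj₂ I) Is
tiling-covers               []                   a≤y y<a = contradiction a≤y (<⇒≱ y<a)
tiling-covers {y = y} (_∷_ {e = e} _ t) a≤y y<b with y ≤? e
... | yes y≤e = here (a≤y , y≤e)
... | no  y≰e = there (tiling-covers t (≰⇒> y≰e) y<b)

tiling⇒partitions : ∀ {a Is b} → Tiling a Is (suc b) → Partitions Is a b
tiling⇒partitions t = tiling-bounds t , tiling-disjoint t , λ _ a≤y y≤b → tiling-covers t a≤y (s≤s y≤b)

tiling-++ : ∀ {a Is b e} → Tiling a Is b → b ≤ e → Tiling a (Is ++ [ (b , e) ]) (suc e)
tiling-++ []        b≤e = b≤e ∷ []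
tiling-++ (a≤e ∷ t) b≤e = a≤e ∷ tiling-++ t b≤e

hapGo-tiling : ∀ (bd : ℕ → Bool) k {s j} → s ≤ j → T (bd (j + k)) →
               Tiling s (hapGo bd s j (suc k)) (suc (j + k))
hapGo-tiling bd zero {j = j} s≤j bd[j] rewrite +-identityʳ j with bd j | bd[j]
... | true | _ = s≤j ∷ []
hapGo-tiling bd (suc k) {j = j} s≤j bd[end] rewrite +-suc j k with bd j
... | true  = s≤j ∷ hapGo-tiling bd k ≤-refl bd[end]
... | false = hapGo-tiling bd k (m≤n⇒m≤1+n s≤j) bd[end]

hapIntervals-tiling : ∀ h m S PA c → Tiling 1 (hapIntervals h m S PA c) (suc m)
hapIntervals-tiling h zero    S PA c = []
hapIntervals-tiling h (suc k) S PA c =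
  hapGo-tiling (isBoundary h (suc k) S PA c) k ≤-refl
    (Equivalence.from T-∨ (inj₁ (≡⇒≡ᵇ (suc k) (suc k) refl)))

-- The pair (L_c , RS[c]) just before the row of c in column j is processed. That the head of
-- L_c contains j is what guarantees that every split produces two nonempty intervals.
data Invariant (m j : ℕ) : List Interval × List Interval → Set where
  finished : ∀ {RS} → Tiling 1 RS (suc m) → Invariant m j ([] , RS)
  ongoing  : ∀ {RS b e Is} → Tiling 1 RS b → b ≤ j → j ≤ e → Tiling (suc e) Is (suc m) →
             Invariant m j ((b , e) ∷ Is , RS)

invariant-start : ∀ {m Is} → Tiling 1 Is (suc m) → Invariant m 1 (Is , [])
invariant-start []        = finished []
invariant-start (1≤e ∷ t) = ongoing [] ≤-refl 1≤e t

invariant⇒partitions : ∀ {m j x e rest RS} → Invariant m j ((x , e) ∷ rest , RS) →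
                       Partitions RS 1 (x ∸ 1) × Partitions ((x , e) ∷ rest) x m
invariant⇒partitions (ongoing done x≤j j≤e todo) with tiling-≤ done
... | s≤s z≤n = tiling⇒partitions done , tiling⇒partitions (≤-trans x≤j j≤e ∷ todo)

-- What a step does to the lists (L_c , RS[c]) of its owner c; active is the outcome of the
-- active-split test, which looks at the lists of another haplotype.
ownerStep : ℕ → Bool → List Interval × List Interval → List Interval × List Interval
ownerStep j active ([] , RS)              = [] , RS
ownerStep j active ((b , e) ∷ Is , RS) =
  if j ≡ᵇ e then Is , RS ++ [ (b , e) ]
  else if active then (suc j , e) ∷ Is , RS ++ [ (b , j) ]
  else (b , e) ∷ Is , RS

ownerStep-invariant : ∀ {m j} active {p} → Invariant m j p → Invariant m (suc j) (ownerStep j active p)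
ownerStep-invariant active (finished done) = finished done
ownerStep-invariant {m} {j} active (ongoing {RS} {b} {e} done b≤j j≤e todo)
  with j ≡ᵇ e | ≡ᵇ⇒≡ j e | ≡⇒≡ᵇ j e
... | true  | j≡e | _ with refl ← j≡e _ = passive todo
  where
  passive : ∀ {Is} → Tiling (suc j) Is (suc m) → Invariant m (suc j) (Is , RS ++ [ (b , j) ])
  passive []             = finished (tiling-++ done b≤j)
  passive (j<e′ ∷ todo′) = ongoing (tiling-++ done b≤j) ≤-refl j<e′ todo′
... | false | _ | j≢e with active
...   | true  = ongoing (tiling-++ done b≤j) ≤-refl (≤∧≢⇒< j≤e j≢e) todo
...   | false = ongoing done (m≤n⇒m≤1+n b≤j) (≤∧≢⇒< j≤e j≢e) todo

listsOf : ℕ → State → List Interval × List Interval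
listsOf c st = State.L st c , State.RS st c

update-same : ∀ {A : Set} (f : ℕ → A) c v → update f c v c ≡ v
update-same f c v = cong (if_then v else f c) (dec-true (c ≟ c) refl)

update-other : ∀ {A : Set} (f : ℕ → A) {c′ v c} → c ≢ c′ → update f c′ v c ≡ f c
update-other f {c′} {v} {c} c≢c′ = cong (if_then v else f c) (dec-false (c ≟ c′) c≢c′)

module _ {d : ℕ} {PA : ℕ → ℕ → ℕ} {j i : ℕ} where

  stepWith-other : ∀ {c′ c} st lst → c ≢ c′ → listsOf c (stepWith d PA j i c′ st lst) ≡ listsOf c st
  stepWith-other st [] _ = refl
  stepWith-other (state L RS) ((b , e) ∷ Is) c≢c′ with j ≡ᵇ e
  ... | true = cong₂ _,_ (update-other L c≢c′) (update-other RS c≢c′)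
  ... | false with (1 <ᵇ i) ∧ (countOverlaps (b , j) (RS (PA j (i ∸ 1))) ≡ᵇ d)
  ...   | true  = cong₂ _,_ (update-other L c≢c′) (update-other RS c≢c′)
  ...   | false = refl

  step-other : ∀ {c} st → PA j i ≢ c → listsOf c (step d PA st (j , i)) ≡ listsOf c st
  step-other st PA≢c = stepWith-other st (State.L st (PA j i)) (PA≢c ∘ sym)

  step-owner : ∀ {c} st → PA j i ≡ c →
               ∃ λ active → listsOf c (step d PA st (j , i)) ≡ ownerStep j active (listsOf c st)
  step-owner {c} (state L RS) refl with L c in Lc≡
  ... | [] = false , cong (_, RS c) Lc≡
  ... | (b , e) ∷ Is with j ≡ᵇ e
  ...   | true = false , cong₂ _,_ (update-same L c Is) (update-same RS c _)
  ...   | false with (1 <ᵇ i) ∧ (countOverlaps (b , j) (RS (PA j (i ∸ 1))) ≡ᵇ d)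
  ...     | true  = true , cong₂ _,_ (update-same L c _) (update-same RS c _)
  ...     | false = false , cong (_, RS c) Lc≡

injective⇒surjective : ∀ {n} (f : Fin n → Fin n) → Injective _≡_ _≡_ f → ∀ y → ∃ λ x → f x ≡ y
injective⇒surjective {suc n} f f-inj y with any? (λ x → f x ≟ᶠ y)
... | yes hit  = hit
... | no  miss = contradiction (injective⇒≤ punchOut∘f-injective) 1+n≰n
  where
  y≢f : ∀ x → y ≢ f x
  y≢f x = miss ∘ (x ,_) ∘ sym
  punchOut∘f-injective : Injective _≡_ _≡_ (λ x → punchOut (y≢f x))
  punchOut∘f-injective eq = f-inj (punchOut-injective (y≢f _) (y≢f _) eq)

module _ {n : ℕ} {f : ℕ → ℕ}
         (maps-to : ∀ x → 1 ≤ x → x ≤ n → 1 ≤ f x × f x ≤ n)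
         (injective : ∀ {x x′} → 1 ≤ x → x < x′ → x′ ≤ n → f x ≢ f x′) where

  private
    pred< : ∀ {v} → 1 ≤ v → v ≤ n → pred v < n
    pred< (s≤s z≤n) v≤n = v≤n

    pred-cancel : ∀ {v w} → 1 ≤ v → 1 ≤ w → pred v ≡ pred w → v ≡ w
    pred-cancel (s≤s z≤n) (s≤s z≤n) = cong suc

    injective′ : ∀ {x x′} → 1 ≤ x → x ≤ n → 1 ≤ x′ → x′ ≤ n → f x ≡ f x′ → x ≡ x′
    injective′ {x} {x′} 1≤x x≤n 1≤x′ x′≤n eq with <-cmp x x′
    ... | tri< x<x′ _ _ = contradiction eq (injective 1≤x x<x′ x′≤n)
    ... | tri≈ _ x≡x′ _ = x≡x′
    ... | tri> _ _ x′<x = contradiction (sym eq) (injective 1≤x′ x′<x x≤n)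

    f-at : ∀ (i : Fin n) → 1 ≤ f (suc (toℕ i)) × f (suc (toℕ i)) ≤ n
    f-at i = maps-to (suc (toℕ i)) (s≤s z≤n) (toℕ<n i)

    -- f read on Fin n through the shift x ↦ x - 1 of domain and codomain
    f̂ : Fin n → Fin n
    f̂ i = fromℕ< (uncurry pred< (f-at i))

    f̂-injective : Injective _≡_ _≡_ f̂
    f̂-injective {i} {i′} eq = toℕ-injective (suc-injective
      (injective′ (s≤s z≤n) (toℕ<n i) (s≤s z≤n) (toℕ<n i′)
        (pred-cancel (proj₁ (f-at i)) (proj₁ (f-at i′)) (fromℕ<-injective _ _ _ _ eq))))

  injectiveOn⇒surjectiveOn : ∀ {y} → 1 ≤ y → y ≤ n → ∃ λ x → 1 ≤ x × x ≤ n × f x ≡ y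
  injectiveOn⇒surjectiveOn 1≤y y≤n
    with i , f̂i≡ŷ ← injective⇒surjective f̂ f̂-injective (fromℕ< (pred< 1≤y y≤n)) =
    suc (toℕ i) , s≤s z≤n , toℕ<n i , pred-cancel (proj₁ (f-at i)) 1≤y (fromℕ<-injective _ _ _ _ f̂i≡ŷ)

precPA-irrefl : ∀ {S j a} → ¬ PrecPA S j a a
precPA-irrefl (inj₁ (_ , _ , _ , Sa<Sa , _)) = <-irrefl refl Sa<Sa
precPA-irrefl (inj₂ (_ , a<a))               = <-irrefl refl a<a

module Column {h m : ℕ} {S PA : ℕ → ℕ → ℕ} (isPA : IsPrefixArray h m S PA)
              {j : ℕ} (1≤j : 1 ≤ j) (j≤m : j ≤ m) where

  prefixArray-injective : ∀ {x x′} → 1 ≤ x → x < x′ → x′ ≤ h → PA j x ≢ PA j x′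
  prefixArray-injective {x′ = x′} 1≤x x<x′ x′≤h eq =
    precPA-irrefl {S} {j} (subst (λ a → PrecPA S j a (PA j x′)) eq (proj₂ (isPA j 1≤j j≤m) _ _ 1≤x x<x′ x′≤h))

  column-distinct : AllPairs (λ a b → PA j a ≢ PA j b) (oneTo h)
  column-distinct = AllPairs.map⁺ (AllPairs.applyUpTo⁺₁ id h
    (λ a<b b<h → prefixArray-injective (s≤s z≤n) (s≤s a<b) b<h))

  owner-in-column : ∀ {c} → 1 ≤ c → c ≤ h → Any (λ i → PA j i ≡ c) (oneTo h)
  owner-in-column 1≤c c≤h
    with suc x , _ , x<h , PAx≡c ←
           injectiveOn⇒surjectiveOn (proj₁ (isPA j 1≤j j≤m)) prefixArray-injective 1≤c c≤h
    = Any.map⁺ (Any.map (λ { refl → PAx≡c }) (∈-upTo⁺ x<h))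

scanl-++⁺ : ∀ {A B : Set} {P : A → Set} (f : A → B → A) z xs {ys} →
            All P (scanl f z xs) → All P (scanl f (foldl f z xs) ys) → All P (scanl f z (xs ++ ys))
scanl-++⁺ f z []       _          Pys = Pys
scanl-++⁺ f z (x ∷ xs) (Pz ∷ Pxs) Pys = Pz ∷ scanl-++⁺ f (f z x) xs Pxs Pys

oneTo-suc : ∀ n → oneTo (suc n) ≡ oneTo n ++ [ suc n ]
oneTo-suc n = begin
  map suc (upTo (suc n))     ≡⟨ cong (map suc) (upTo-∷ʳ n) ⟨
  map suc (upTo n ++ [ n ])  ≡⟨ map-++ suc (upTo n) [ n ] ⟩
  oneTo n ++ [ suc n ]       ∎
  where open ≡-Reasoning

schedule-suc : ∀ h n → schedule h (suc n) ≡ schedule h n ++ map (suc n ,_) (oneTo h)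
schedule-suc h n = begin
  concatMap row (oneTo (suc n))            ≡⟨ cong (concatMap row) (oneTo-suc n) ⟩
  concatMap row (oneTo n ++ [ suc n ])     ≡⟨ concatMap-++ row (oneTo n) [ suc n ] ⟩
  schedule h n ++ row (suc n) ++ []        ≡⟨ cong (schedule h n ++_) (++-identityʳ (row (suc n))) ⟩
  schedule h n ++ row (suc n)              ∎
  where
  open ≡-Reasoning
  row : ℕ → List (ℕ × ℕ)
  row j = map (j ,_) (oneTo h)

module Run {d m c : ℕ} {PA : ℕ → ℕ → ℕ} where

  InvariantHolds : State → Set
  InvariantHolds st = ∃ λ j → Invariant m j (listsOf c st)

  others-run : ∀ {j st rows} → All (λ i → PA j i ≢ c) rows →
               All (λ s → listsOf c s ≡ listsOf c st) (scanl (step d PA) st (map (j ,_) rows)) ×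
               listsOf c (foldl (step d PA) st (map (j ,_) rows)) ≡ listsOf c st
  others-run [] = refl ∷ [] , refl
  others-run {st = st} (PA≢c ∷ rest) =
    let unchanged , unchanged-end = others-run rest
        same = step-other st PA≢c
    in refl ∷ All.map (λ eq → trans eq same) unchanged , trans unchanged-end same

  column-run : ∀ {j st rows} → Invariant m j (listsOf c st) →
               Any (λ i → PA j i ≡ c) rows → AllPairs (λ a b → PA j a ≢ PA j b) rows →
               All InvariantHolds (scanl (step d PA) st (map (j ,_) rows)) ×
               Invariant m (suc j) (listsOf c (foldl (step d PA) st (map (j ,_) rows)))
  column-run {j} {st} inv (here owner) (distinct ∷ _) =
    let active , stepped = step-owner st owner
        inv′ = subst (Invariant m (suc j)) (sym stepped) (ownerStep-invariant active inv)
        unchanged , unchanged-end =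
          others-run (All.map (λ PAi≢PAb PAb≡c → PAi≢PAb (trans owner (sym PAb≡c))) distinct)
    in (j , inv) ∷ All.map (λ eq → suc j , subst (Invariant m (suc j)) (sym eq) inv′) unchanged ,
       subst (Invariant m (suc j)) (sym unchanged-end) inv′
  column-run {j} {st} inv (there owner∈rows) (distinct ∷ distincts) =
    let not-owner PAi≡c =
          All¬⇒¬Any (All.map (λ PAi≢PAb PAb≡c → PAi≢PAb (trans PAi≡c (sym PAb≡c))) distinct) owner∈rows
        inv′ = subst (Invariant m j) (sym (step-other st not-owner)) inv
        later , inv-end = column-run inv′ owner∈rows distincts
    in (j , inv) ∷ later , inv-end

module Execution {h m d : ℕ} {S PA : ℕ → ℕ → ℕ} (isPA : IsPrefixArray h m S PA)
                 {c : ℕ} (1≤c : 1 ≤ c) (c≤h : c ≤ h) where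

  open Run {d} {m} {c} {PA}

  columns-run : ∀ n → n ≤ m →
                All InvariantHolds (scanl (step d PA) (initState h m S PA) (schedule h n)) ×
                Invariant m (suc n) (listsOf c (foldl (step d PA) (initState h m S PA) (schedule h n)))
  columns-run zero _ = (1 , start) ∷ [] , start
    where start = invariant-start (hapIntervals-tiling h m S PA c)
  columns-run (suc n) n<m
    rewrite schedule-suc h n
          | foldl-++ (step d PA) (initState h m S PA) (schedule h n) (map (suc n ,_) (oneTo h)) =
    let before , inv = columns-run n (<⇒≤ n<m)
        open Column {S = S} isPA (s≤s z≤n) n<m
        during , after = column-run inv (owner-in-column 1≤c c≤h) column-distinct
    in scanl-++⁺ (step d PA) (initState h m S PA) (schedule h n) before during , after

  states-invariant : All InvariantHolds (states h m d S PA)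
  states-invariant = proj₁ (columns-run m ≤-refl)

-- The invariant holds for every threshold d.
lemma5 : (h m d : ℕ) (S PA : ℕ → ℕ → ℕ) → IsPrefixArray h m S PA → 1 < d →
         (c : ℕ) → 1 ≤ c → c ≤ h →
         (st : State) → st ∈ states h m d S PA →
         (x e : ℕ) (rest : List Interval) → State.L st c ≡ (x , e) ∷ rest →
         Partitions (State.RS st c) 1 (x ∸ 1) × Partitions (State.L st c) x m
lemma5 h m d S PA isPA _ c 1≤c c≤h st st∈states x e rest Lc≡
  with _ , inv ← All.lookup (Execution.states-invariant {d = d} {S} isPA 1≤c c≤h) st∈states
  rewrite Lc≡ = invariant⇒partitions inv
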